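{- Let ${\mathbf G}$ be a finite abelian group, $r\geq2$ and $k_1,\dots,k_r\geq2$ integers, $K=\prod_{j=1}^rk_j$, and let $f:{\mathbf G}\to\mathbb{R}$. Suppose there is $j\in[r]$ such that $k_j$ is even and $K/k_j$ is even. Then $\|f\|^K_{E_{k_1,\dots,k_r}}=0$ if and only if $f\equiv0$.
   Context: Let $B=[k_1]\times\dots\times[k_r]$. For $x_i=(x_i^{(1)},\dots,x_i^{(k_i)})\in{\mathbf G}^{k_i}$, define $\|f\|^K_{E_{k_1,\dots,k_r}}=\sum_{x_1\in{\mathbf G}^{k_1}}\cdots\sum_{x_r\in{\mathbf G}^{k_r}}\prod_{\omega\in B}f(x_1^{(\omega_1)}+\dots+x_r^{(\omega_r)})$ (this quantity is denoted as a $K$-th power but is defined by this sum). -}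

module Defs where

open import Data.Nat as ℕ using (ℕ; zero; suc)
open import Data.Fin using (Fin; zero; suc; _≟_)
open import Data.Product using (∃)
open import Relation.Binary.PropositionalEquality using (_≡_)
open import Relation.Nullary using (¬_; yes; no)
open import Algebra.Structures using (IsAbelianGroup; IsCommutativeRing)
open import Relation.Binary.Structures using (IsTotalOrder)
open import Function.Bundles using (_↔_; Inverse)

record FiniteAbelianGroup : Set₁ where
  field
    Carrier        : Set
    _+_            : Carrier → Carrier → Carrier
    0#             : Carrier
    -_             : Carrier → Carrier
    isAbelianGroup : IsAbelianGroup _≡_ _+_ 0# -_
    size           : ℕ
    enum           : Fin size ↔ Carrier

-- An ordered field (the real numbers are an instance); the codomain of f.
record OrderedField : Set₁ where
  field
    Carrier           : Set
    _+_ _*_           : Carrier → Carrier → Carrier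
    -_                : Carrier → Carrier
    0# 1#             : Carrier
    isCommutativeRing : IsCommutativeRing _≡_ _+_ _*_ -_ 0# 1#
    0≢1               : ¬ (0# ≡ 1#)
    inverse           : ∀ x → ¬ (x ≡ 0#) → ∃ λ y → x * y ≡ 1#
    _≤_               : Carrier → Carrier → Set
    isTotalOrder      : IsTotalOrder _≡_ _≤_
    +-mono-≤          : ∀ {a b} c → a ≤ b → (a + c) ≤ (b + c)
    *-nonneg          : ∀ {a b} → 0# ≤ a → 0# ≤ b → 0# ≤ (a * b)

prodℕ : (r : ℕ) → (Fin r → ℕ) → ℕ
prodℕ zero    ks = 1
prodℕ (suc r) ks = ks zero ℕ.* prodℕ r (λ i → ks (suc i))

-- K / k_j  =  ∏_{i ≠ j} k_i
prodExcept : (r : ℕ) → (Fin r → ℕ) → Fin r → ℕ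
prodExcept r ks j = prodℕ r (λ i → f i (i ≟ j))
  where
  f : (i : Fin r) → _ → ℕ
  f i (yes _) = 1
  f i (no _)  = ks i

module _ (G : FiniteAbelianGroup) (F : OrderedField) where
  private
    module G = FiniteAbelianGroup G
    module F = OrderedField F

  sumFin : (n : ℕ) → (Fin n → F.Carrier) → F.Carrier
  sumFin zero    h = F.0#
  sumFin (suc n) h = h zero F.+ sumFin n (λ i → h (suc i))

  prodFin : (n : ℕ) → (Fin n → F.Carrier) → F.Carrier
  prodFin zero    h = F.1#
  prodFin (suc n) h = h zero F.* prodFin n (λ i → h (suc i))

  sumG : (G.Carrier → F.Carrier) → F.Carrier
  sumG h = sumFin G.size (λ i → h (Inverse.to G.enum i))

  sumGk : (k : ℕ) → ((Fin k → G.Carrier) → F.Carrier) → F.Carrier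
  sumGk zero    h = h (λ ())
  sumGk (suc k) h = sumG (λ g → sumGk k (λ v → h (cons g v)))
    where
    cons : G.Carrier → (Fin k → G.Carrier) → Fin (suc k) → G.Carrier
    cons g v zero    = g
    cons g v (suc i) = v i

  sumTuples : (r : ℕ) (ks : Fin r → ℕ)
            → (((j : Fin r) → Fin (ks j) → G.Carrier) → F.Carrier) → F.Carrier
  sumTuples zero    ks h = h (λ ())
  sumTuples (suc r) ks h =
    sumGk (ks zero) (λ x → sumTuples r (λ i → ks (suc i)) (λ y → h (cons x y)))
    where
    cons : (Fin (ks zero) → G.Carrier) → ((i : Fin r) → Fin (ks (suc i)) → G.Carrier)
         → (j : Fin (suc r)) → Fin (ks j) → G.Carrier
    cons x y zero    = x
    cons x y (suc i) = y i

  prodBox : (r : ℕ) (ks : Fin r → ℕ) → (((j : Fin r) → Fin (ks j)) → F.Carrier) → F.Carrier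
  prodBox zero    ks h = h (λ ())
  prodBox (suc r) ks h =
    prodFin (ks zero) (λ a → prodBox r (λ i → ks (suc i)) (λ ω → h (cons a ω)))
    where
    cons : Fin (ks zero) → ((i : Fin r) → Fin (ks (suc i))) → (j : Fin (suc r)) → Fin (ks j)
    cons a ω zero    = a
    cons a ω (suc i) = ω i

  sumGrp : (r : ℕ) → (Fin r → G.Carrier) → G.Carrier
  sumGrp zero    g = G.0#
  sumGrp (suc r) g = g zero G.+ sumGrp r (λ i → g (suc i))

  normEK : (r : ℕ) (ks : Fin r → ℕ) → (G.Carrier → F.Carrier) → F.Carrier
  normEK r ks f =
    sumTuples r ks (λ x → prodBox r ks (λ ω → f (sumGrp r (λ j → x j (ω j)))))

-- Split off the first block x₁ ∈ Gᵏ¹ of summation variables. Summing over x₁ first gives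
--   ‖f‖ = ∑_{x₂,…,x_r} (∑_t ∏_{ω₂,…,ω_r} f(t + x₂^{ω₂} + ⋯ + x_r^{ω_r}))^{k₁},
-- which is nonnegative when k₁ is even; summing over x₁ last gives
--   ‖f‖_{E_{k₁,…,k_r}} = ∑_{x₁} ‖∏_a f(x₁^{(a)} + ·)‖_{E_{k₂,…,k_r}},
-- so by induction ‖f‖ ≥ 0 as soon as some k_j is even. If moreover ‖f‖ = 0, every term of the
-- relevant decomposition vanishes, in particular the one where the split-off variables are 0,
-- which gives ∑_t f(t)^{K/k₁} = 0 in the first case and ‖f^{k₁}‖_{E_{k₂,…,k_r}} = 0 in the second.
-- Inductively ∑_t f(t)^{K/k_j} = 0, and as K/k_j is even each f(t)^{K/k_j} vanishes, hence f = 0.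
module Submission where

open import Defs
open import Data.Nat using (ℕ)
open import Data.Nat.Divisibility using (_∣_)
open import Data.Fin using (Fin)
open import Data.Product using (∃; _×_)
open import Relation.Binary.PropositionalEquality using (_≡_)
open import Function.Bundles using (_⇔_)

import Data.Nat as ℕ
import Data.Nat.Properties as ℕ
open import Data.Nat using (zero; suc)
open import Data.Nat.Divisibility using (divides)
open import Data.Fin using (zero; suc; _≟_; fromℕ<)
open import Data.Fin.Properties using (∀-cons)
open import Data.Bool as Bool using (Bool)
open import Data.Maybe using (is-just)
open import Data.Sum using (_⊎_; inj₁; inj₂; isInj₁)
open import Data.Product using (_,_)
open import Function using (_∘_)
open import Function.Bundles using (mk⇔; Inverse)
open import Relation.Nullary using (¬_; yes; no)
open import Relation.Nullary.Decidable using (decidable-stable)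
open import Relation.Binary.PropositionalEquality
  using (refl; sym; trans; cong; cong₂; subst; subst₂; module ≡-Reasoning)
open import Relation.Binary.Structures using (IsTotalOrder)
open import Algebra.Bundles using (CommutativeRing)
open import Algebra.Structures using (IsAbelianGroup; IsCommutativeRing)
import Algebra.Properties.Ring as RingProperties
import Algebra.Properties.Semiring.Exp as ExpProperties
import Algebra.Properties.Semiring.Sum as SemiringSum
import Algebra.Properties.CommutativeMonoid.Sum as CommutativeMonoidSum

prodℕ-cong : ∀ n {h g : Fin n → ℕ} → (∀ i → h i ≡ g i) → prodℕ n h ≡ prodℕ n g
prodℕ-cong zero    h≗g = refl
prodℕ-cong (suc n) h≗g = cong₂ ℕ._*_ (h≗g zero) (prodℕ-cong n (h≗g ∘ suc))

prodExcept-zero : ∀ r ks → prodExcept (suc r) ks zero ≡ prodℕ r (ks ∘ suc)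
prodExcept-zero r ks = ℕ.*-identityˡ _

prodExcept-suc : ∀ r ks j →
                 prodExcept (suc r) ks (suc j) ≡ ks zero ℕ.* prodExcept r (ks ∘ suc) j
prodExcept-suc r ks j = cong (ks zero ℕ.*_) (prodℕ-cong r factors-agree)
  where
  -- The factors of prodExcept are given by a function local to Defs, which cannot be named;
  -- the metas below are solved by the two unfoldings, and then analysed by cases on i ≟ j.
  factor factor′ : Fin r → ℕ
  factor i  = _
  factor′ i = _
  unfold : prodExcept (suc r) ks (suc j) ≡ ks zero ℕ.* prodℕ r factor
  unfold = refl
  unfold′ : prodExcept r (ks ∘ suc) j ≡ prodℕ r factor′
  unfold′ = refl
  factors-agree : ∀ i → factor i ≡ factor′ i
  factors-agree i with i ≟ j
  ... | yes _ = refl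
  ... | no _  = refl

module _ {R : Set} where

  Congruent : {A : Set} → ((A → R) → R) → Set
  Congruent {A} op = ∀ {h h′ : A → R} → (∀ x → h x ≡ h′ x) → op h ≡ op h′

  iterated : (n : ℕ) {P : Fin n → Set} →
             (∀ j → (P j → R) → R) → (((j : Fin n) → P j) → R) → R
  iterated zero    op h = h (λ ())
  iterated (suc n) op h = op zero (λ x → iterated n (op ∘ suc) (λ y → h (∀-cons x y)))

  iterated-cong : ∀ n {P : Fin n → Set} (op : ∀ j → (P j → R) → R) →
                  (∀ j → Congruent (op j)) → Congruent (iterated n op)
  iterated-cong zero    op op-cong h≗h′ = h≗h′ _
  iterated-cong (suc n) op op-cong h≗h′ =
    op-cong zero (λ x → iterated-cong n (op ∘ suc) (op-cong ∘ suc) (λ y → h≗h′ _))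

  iterated-preserves : ∀ n {P : Fin n → Set} (op : ∀ j → (P j → R) → R) (Q : R → Set) →
                       (∀ j h → (∀ x → Q (h x)) → Q (op j h)) →
                       ∀ h → (∀ x → Q (h x)) → Q (iterated n op h)
  iterated-preserves zero    op Q op-Q h h-Q = h-Q _
  iterated-preserves (suc n) op Q op-Q h h-Q =
    op-Q zero _ (λ x → iterated-preserves n (op ∘ suc) Q (op-Q ∘ suc) _ (λ y → h-Q _))

  iterated-homo : ∀ n {P : Fin n → Set} (op : ∀ j → (P j → R) → R) (φ : R → R) →
                  (∀ j → Congruent (op j)) → (∀ j h → op j (λ x → φ (h x)) ≡ φ (op j h)) →
                  ∀ h → iterated n op (λ x → φ (h x)) ≡ φ (iterated n op h)
  iterated-homo zero    op φ op-cong op-homo h = refl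
  iterated-homo (suc n) op φ op-cong op-homo h = trans
    (op-cong zero (λ x → iterated-homo n (op ∘ suc) φ (op-cong ∘ suc) (op-homo ∘ suc) _))
    (op-homo zero _)

  iterated-comm : ∀ n {P : Fin n → Set} (op : ∀ j → (P j → R) → R)
                  {A : Set} (op′ : (A → R) → R) →
                  (∀ j → Congruent (op j)) → Congruent op′ →
                  (∀ j (h : P j → A → R) →
                     op j (λ x → op′ (h x)) ≡ op′ (λ a → op j (λ x → h x a))) →
                  ∀ (h : ((j : Fin n) → P j) → A → R) →
                  iterated n op (λ x → op′ (h x)) ≡ op′ (λ a → iterated n op (λ x → h x a))
  iterated-comm zero    op op′ op-cong op′-cong op-comm h = refl
  iterated-comm (suc n) op op′ op-cong op′-cong op-comm h = trans
    (op-cong zero (λ x →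
       iterated-comm n (op ∘ suc) op′ (op-cong ∘ suc) op′-cong (op-comm ∘ suc) _))
    (op-comm zero _)

  iterated-witness : ∀ n {P : Fin n → Set} (op : ∀ j → (P j → R) → R)
                     (Q V : R → Set) (Z : ∀ j → P j → Set) →
                     (∀ j h → (∀ x → Q (h x)) → Q (op j h)) →
                     (∀ j h → (∀ x → Q (h x)) → V (op j h) → ∃ λ x → Z j x × V (h x)) →
                     ∀ h → (∀ x → Q (h x)) → V (iterated n op h) →
                     ∃ λ x → (∀ j → Z j (x j)) × V (h x)
  iterated-witness zero    op Q V Z op-Q op-V h h-Q Vh = _ , (λ ()) , Vh
  iterated-witness (suc n) op Q V Z op-Q op-V h h-Q Vh =
    let x , Zx , Vx = op-V zero _ (λ _ → iterated-preserves n _ Q (op-Q ∘ suc) _ (λ _ → h-Q _)) Vh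
        y , Zy , Vy = iterated-witness n _ Q V (Z ∘ suc) (op-Q ∘ suc) (op-V ∘ suc) _ (λ _ → h-Q _) Vx
    in ∀-cons x y , ∀-cons Zx Zy , Vy

module OrderedFieldProperties (F : OrderedField) where
  open OrderedField F
    renaming (_+_ to infixl 6 _+_; _*_ to infixl 7 _*_; -_ to infix 8 -_; _≤_ to infix 4 _≤_)
  open IsCommutativeRing isCommutativeRing
    using (+-identityˡ; +-identityʳ; -‿inverseˡ; -‿inverseʳ;
           *-identityˡ; *-identityʳ; *-assoc; *-comm; zeroʳ)
  open IsTotalOrder isTotalOrder using (total; antisym) renaming (trans to ≤-trans)
  open ≡-Reasoning

  commutativeRing : CommutativeRing _ _
  commutativeRing = record { isCommutativeRing = isCommutativeRing }

  open CommutativeRing commutativeRing public using (semiring; *-commutativeMonoid)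
  open RingProperties (CommutativeRing.ring commutativeRing)
    using (-0#≈0#; -‿distribˡ-*; -‿distribʳ-*; -‿involutive)
  open ExpProperties semiring public using (_^_; ^-assocʳ)

  0≤-x⇒x≤0 : ∀ {x} → 0# ≤ - x → x ≤ 0#
  0≤-x⇒x≤0 {x} 0≤-x = subst₂ _≤_ (+-identityˡ x) (-‿inverseˡ x) (+-mono-≤ x 0≤-x)

  -x≤0⇒0≤x : ∀ {x} → - x ≤ 0# → 0# ≤ x
  -x≤0⇒0≤x {x} -x≤0 = subst₂ _≤_ (-‿inverseˡ x) (+-identityˡ x) (+-mono-≤ x -x≤0)

  x≤0⇒0≤-x : ∀ {x} → x ≤ 0# → 0# ≤ - x
  x≤0⇒0≤-x {x} x≤0 = subst₂ _≤_ (-‿inverseʳ x) (+-identityˡ (- x)) (+-mono-≤ (- x) x≤0)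

  0≤x*x : ∀ x → 0# ≤ x * x
  0≤x*x x with total 0# x
  ... | inj₁ 0≤x = *-nonneg 0≤x 0≤x
  ... | inj₂ x≤0 = subst (0# ≤_) -x*-x≡x*x (*-nonneg (x≤0⇒0≤-x x≤0) (x≤0⇒0≤-x x≤0))
    where
    -x*-x≡x*x : - x * - x ≡ x * x
    -x*-x≡x*x = begin
      - x * - x     ≡⟨ -‿distribʳ-* (- x) x ⟨
      - (- x * x)   ≡⟨ cong -_ (-‿distribˡ-* x x) ⟨
      - (- (x * x)) ≡⟨ -‿involutive (x * x) ⟩
      x * x         ∎

  0≤x^even : ∀ {n} → 2 ∣ n → ∀ x → 0# ≤ x ^ n
  0≤x^even (divides m refl) x = subst (0# ≤_) x^m*x^m≡x^[m*2] (0≤x*x (x ^ m))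
    where
    x^m*x^m≡x^[m*2] : x ^ m * x ^ m ≡ x ^ (m ℕ.* 2)
    x^m*x^m≡x^[m*2] = trans (cong (x ^ m *_) (sym (*-identityʳ (x ^ m)))) (^-assocʳ x m 2)

  0≤x+y : ∀ {x y} → 0# ≤ x → 0# ≤ y → 0# ≤ x + y
  0≤x+y {x} {y} 0≤x 0≤y = ≤-trans 0≤y (subst (_≤ x + y) (+-identityˡ y) (+-mono-≤ y 0≤x))

  x+y≡0⇒x≡0×y≡0 : ∀ {x y} → 0# ≤ x → 0# ≤ y → x + y ≡ 0# → x ≡ 0# × y ≡ 0#
  x+y≡0⇒x≡0×y≡0 {x} {y} 0≤x 0≤y x+y≡0 = x≡0 , y≡0
    where
    y≡0 : y ≡ 0#
    y≡0 = antisym (subst₂ _≤_ (+-identityˡ y) x+y≡0 (+-mono-≤ y 0≤x)) 0≤y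
    x≡0 : x ≡ 0#
    x≡0 = begin
      x      ≡⟨ +-identityʳ x ⟨
      x + 0# ≡⟨ cong (x +_) y≡0 ⟨
      x + y  ≡⟨ x+y≡0 ⟩
      0#     ∎

  private
    isLeft : ∀ {A B : Set} → A ⊎ B → Bool
    isLeft = is-just ∘ isInj₁

    sameSide⇒x≡0 : ∀ {x} (d : x ≤ 0# ⊎ 0# ≤ x) (e : - x ≤ 0# ⊎ 0# ≤ - x) →
                   isLeft d ≡ isLeft e → x ≡ 0#
    sameSide⇒x≡0 (inj₁ x≤0) (inj₁ -x≤0) _ = antisym x≤0 (-x≤0⇒0≤x -x≤0)
    sameSide⇒x≡0 (inj₂ 0≤x) (inj₂ 0≤-x) _ = antisym (0≤-x⇒x≤0 0≤-x) 0≤x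

    x≡0⇒sameSide : ∀ {x} → x ≡ 0# → isLeft (total x 0#) ≡ isLeft (total (- x) 0#)
    x≡0⇒sameSide refl rewrite -0#≈0# = refl

  -- Equality with 0# need not be decidable, but it is stable: totality compares x and - x with 0#,
  -- and when x ≡ 0# both comparisons are the same term, hence fall on the same side.
  x≡0-stable : ∀ x → ¬ ¬ (x ≡ 0#) → x ≡ 0#
  x≡0-stable x ¬¬x≡0 = sameSide⇒x≡0 (total x 0#) (total (- x) 0#)
    (decidable-stable (_ Bool.≟ _) (λ differ → ¬¬x≡0 (differ ∘ x≡0⇒sameSide)))

  x*y≢0 : ∀ {x y} → ¬ (x ≡ 0#) → ¬ (y ≡ 0#) → ¬ (x * y ≡ 0#)
  x*y≢0 {x} {y} x≢0 y≢0 x*y≡0 with inverse x x≢0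
  ... | x⁻¹ , x*x⁻¹≡1 = y≢0 (begin
    y              ≡⟨ *-identityˡ y ⟨
    1# * y         ≡⟨ cong (_* y) x*x⁻¹≡1 ⟨
    x * x⁻¹ * y    ≡⟨ cong (_* y) (*-comm x x⁻¹) ⟩
    x⁻¹ * x * y    ≡⟨ *-assoc x⁻¹ x y ⟩
    x⁻¹ * (x * y)  ≡⟨ cong (x⁻¹ *_) x*y≡0 ⟩
    x⁻¹ * 0#       ≡⟨ zeroʳ x⁻¹ ⟩
    0#             ∎)

  x^n≢0 : ∀ {x} → ¬ (x ≡ 0#) → ∀ n → ¬ (x ^ n ≡ 0#)
  x^n≢0 x≢0 zero    1≡0 = 0≢1 (sym 1≡0)
  x^n≢0 x≢0 (suc n) = x*y≢0 x≢0 (x^n≢0 x≢0 n)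

  x^n≡0⇒x≡0 : ∀ {x} n → x ^ n ≡ 0# → x ≡ 0#
  x^n≡0⇒x≡0 {x} n x^n≡0 = x≡0-stable x (λ x≢0 → x^n≢0 x≢0 n x^n≡0)

module Norm (G : FiniteAbelianGroup) (F : OrderedField) where
  open FiniteAbelianGroup G using (size; enum; isAbelianGroup)
    renaming (Carrier to 𝔾; _+_ to infixl 6 _⊕_; 0# to 0ᴳ)
  open OrderedField F
    renaming (Carrier to R; _+_ to infixl 6 _+_; _*_ to infixl 7 _*_; _≤_ to infix 4 _≤_)
  open IsAbelianGroup isAbelianGroup
    using () renaming (identityˡ to ⊕-identityˡ; identityʳ to ⊕-identityʳ)
  open IsCommutativeRing isCommutativeRing using (*-identityʳ; zeroˡ; zeroʳ)
  open OrderedFieldProperties F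
  open Inverse enum using (to; from; strictlyInverseˡ)
  module Σ = SemiringSum semiring
  module Π = CommutativeMonoidSum *-commutativeMonoid
  open ≡-Reasoning

  sumFin≡sum : ∀ n h → sumFin G F n h ≡ Σ.sum h
  sumFin≡sum zero    h = refl
  sumFin≡sum (suc n) h = cong (h zero +_) (sumFin≡sum n (h ∘ suc))

  sumFin-cong : ∀ n {h g} → (∀ i → h i ≡ g i) → sumFin G F n h ≡ sumFin G F n g
  sumFin-cong n {h} {g} h≗g = begin
    sumFin G F n h ≡⟨ sumFin≡sum n h ⟩
    Σ.sum h        ≡⟨ Σ.sum-cong-≗ h≗g ⟩
    Σ.sum g        ≡⟨ sumFin≡sum n g ⟨
    sumFin G F n g ∎

  sumFin-comm : ∀ m n (h : Fin m → Fin n → R) →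
                sumFin G F m (λ i → sumFin G F n (h i)) ≡
                sumFin G F n (λ j → sumFin G F m (λ i → h i j))
  sumFin-comm m n h = begin
    sumFin G F m (λ i → sumFin G F n (h i))
      ≡⟨ sumFin≡sum m _ ⟩
    Σ.sum (λ i → sumFin G F n (h i))
      ≡⟨ Σ.sum-cong-≗ (λ i → sumFin≡sum n (h i)) ⟩
    Σ.sum (λ i → Σ.sum (h i))
      ≡⟨ Σ.∑-comm h ⟩
    Σ.sum (λ j → Σ.sum (λ i → h i j))
      ≡⟨ Σ.sum-cong-≗ (λ j → sumFin≡sum m (λ i → h i j)) ⟨
    Σ.sum (λ j → sumFin G F m (λ i → h i j))
      ≡⟨ sumFin≡sum n _ ⟨
    sumFin G F n (λ j → sumFin G F m (λ i → h i j)) ∎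

  sumFin-*ˡ : ∀ n c h → sumFin G F n (λ i → c * h i) ≡ c * sumFin G F n h
  sumFin-*ˡ n c h = begin
    sumFin G F n (λ i → c * h i) ≡⟨ sumFin≡sum n _ ⟩
    Σ.sum (λ i → c * h i)        ≡⟨ Σ.*-distribˡ-sum c h ⟨
    c * Σ.sum h                  ≡⟨ cong (c *_) (sumFin≡sum n h) ⟨
    c * sumFin G F n h           ∎

  sumFin-*ʳ : ∀ n h c → sumFin G F n (λ i → h i * c) ≡ sumFin G F n h * c
  sumFin-*ʳ n h c = begin
    sumFin G F n (λ i → h i * c) ≡⟨ sumFin≡sum n _ ⟩
    Σ.sum (λ i → h i * c)        ≡⟨ Σ.*-distribʳ-sum c h ⟨
    Σ.sum h * c                  ≡⟨ cong (_* c) (sumFin≡sum n h) ⟨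
    sumFin G F n h * c           ∎

  sumFin-zero : ∀ n {h} → (∀ i → h i ≡ 0#) → sumFin G F n h ≡ 0#
  sumFin-zero n h≗0 = trans (sumFin-cong n h≗0) (trans (sumFin≡sum n _) (Σ.sum-replicate-zero n))

  sumFin-nonneg : ∀ n h → (∀ i → 0# ≤ h i) → 0# ≤ sumFin G F n h
  sumFin-nonneg zero    h 0≤h = IsTotalOrder.refl isTotalOrder
  sumFin-nonneg (suc n) h 0≤h = 0≤x+y (0≤h zero) (sumFin-nonneg n (h ∘ suc) (0≤h ∘ suc))

  sumFin≡0⇒h≡0 : ∀ n h → (∀ i → 0# ≤ h i) → sumFin G F n h ≡ 0# → ∀ i → h i ≡ 0#
  sumFin≡0⇒h≡0 (suc n) h 0≤h sum≡0 i
    with x+y≡0⇒x≡0×y≡0 (0≤h zero) (sumFin-nonneg n (h ∘ suc) (0≤h ∘ suc)) sum≡0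
  sumFin≡0⇒h≡0 (suc n) h 0≤h sum≡0 zero    | h₀≡0 , _ = h₀≡0
  sumFin≡0⇒h≡0 (suc n) h 0≤h sum≡0 (suc i) | _ , rest≡0 =
    sumFin≡0⇒h≡0 n (h ∘ suc) (0≤h ∘ suc) rest≡0 i

  sumG-cong : ∀ {h g} → (∀ x → h x ≡ g x) → sumG G F h ≡ sumG G F g
  sumG-cong h≗g = sumFin-cong size (h≗g ∘ to)

  sumG-comm : ∀ (h : 𝔾 → 𝔾 → R) →
              sumG G F (λ x → sumG G F (h x)) ≡ sumG G F (λ y → sumG G F (λ x → h x y))
  sumG-comm h = sumFin-comm size size (λ i j → h (to i) (to j))

  sumG-*ˡ : ∀ c h → sumG G F (λ x → c * h x) ≡ c * sumG G F h
  sumG-*ˡ c h = sumFin-*ˡ size c (h ∘ to)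

  sumG-*ʳ : ∀ h c → sumG G F (λ x → h x * c) ≡ sumG G F h * c
  sumG-*ʳ h c = sumFin-*ʳ size (h ∘ to) c

  sumG-zero : ∀ {h} → (∀ x → h x ≡ 0#) → sumG G F h ≡ 0#
  sumG-zero h≗0 = sumFin-zero size (h≗0 ∘ to)

  sumG-nonneg : ∀ h → (∀ x → 0# ≤ h x) → 0# ≤ sumG G F h
  sumG-nonneg h 0≤h = sumFin-nonneg size (h ∘ to) (0≤h ∘ to)

  sumG≡0⇒h≡0 : ∀ h → (∀ x → 0# ≤ h x) → sumG G F h ≡ 0# → ∀ x → h x ≡ 0#
  sumG≡0⇒h≡0 h 0≤h sum≡0 x = subst (λ y → h y ≡ 0#) (strictlyInverseˡ x)
    (sumFin≡0⇒h≡0 size (h ∘ to) (0≤h ∘ to) sum≡0 (from x))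

  prodFin≡product : ∀ n h → prodFin G F n h ≡ Π.sum h
  prodFin≡product zero    h = refl
  prodFin≡product (suc n) h = cong (h zero *_) (prodFin≡product n (h ∘ suc))

  prodFin-cong : ∀ n {h g} → (∀ i → h i ≡ g i) → prodFin G F n h ≡ prodFin G F n g
  prodFin-cong n {h} {g} h≗g = begin
    prodFin G F n h ≡⟨ prodFin≡product n h ⟩
    Π.sum h         ≡⟨ Π.sum-cong-≗ h≗g ⟩
    Π.sum g         ≡⟨ prodFin≡product n g ⟨
    prodFin G F n g ∎

  prodFin-comm : ∀ m n (h : Fin m → Fin n → R) →
                 prodFin G F m (λ i → prodFin G F n (h i)) ≡
                 prodFin G F n (λ j → prodFin G F m (λ i → h i j))
  prodFin-comm m n h = begin
    prodFin G F m (λ i → prodFin G F n (h i))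
      ≡⟨ prodFin≡product m _ ⟩
    Π.sum (λ i → prodFin G F n (h i))
      ≡⟨ Π.sum-cong-≗ (λ i → prodFin≡product n (h i)) ⟩
    Π.sum (λ i → Π.sum (h i))
      ≡⟨ Π.∑-comm h ⟩
    Π.sum (λ j → Π.sum (λ i → h i j))
      ≡⟨ Π.sum-cong-≗ (λ j → prodFin≡product m (λ i → h i j)) ⟨
    Π.sum (λ j → prodFin G F m (λ i → h i j))
      ≡⟨ prodFin≡product n _ ⟨
    prodFin G F n (λ j → prodFin G F m (λ i → h i j)) ∎

  prodFin-const : ∀ n x → prodFin G F n (λ _ → x) ≡ x ^ n
  prodFin-const zero    x = refl
  prodFin-const (suc n) x = cong (x *_) (prodFin-const n x)

  prodFin-zero : ∀ n h (i : Fin n) → h i ≡ 0# → prodFin G F n h ≡ 0#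
  prodFin-zero (suc n) h zero    h₀≡0 =
    trans (cong (_* prodFin G F n (h ∘ suc)) h₀≡0) (zeroˡ _)
  prodFin-zero (suc n) h (suc i) hᵢ≡0 =
    trans (cong (h zero *_) (prodFin-zero n (h ∘ suc) i hᵢ≡0)) (zeroʳ _)

  -- Defs builds its iterated sums with local cons functions, a different one for every summand,
  -- so that none of them is congruent without function extensionality. The primed versions use
  -- ∀-cons instead; they agree with those of Defs on summands respecting pointwise equality.
  sumGk′ : (k : ℕ) → ((Fin k → 𝔾) → R) → R
  sumGk′ k = iterated k (λ _ → sumG G F)

  sumTuples′ : (r : ℕ) (ks : Fin r → ℕ) → (((j : Fin r) → Fin (ks j) → 𝔾) → R) → R
  sumTuples′ r ks = iterated r (λ j → sumGk′ (ks j))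

  prodBox′ : (r : ℕ) (ks : Fin r → ℕ) → (((j : Fin r) → Fin (ks j)) → R) → R
  prodBox′ r ks = iterated r (λ j → prodFin G F (ks j))

  normEK′ : (r : ℕ) (ks : Fin r → ℕ) → (𝔾 → R) → R
  normEK′ r ks f =
    sumTuples′ r ks (λ x → prodBox′ r ks (λ ω → f (sumGrp G F r (λ j → x j (ω j)))))

  sumGk′-cong : ∀ k → Congruent (sumGk′ k)
  sumGk′-cong k = iterated-cong k _ (λ _ → sumG-cong)

  sumGk′-nonneg : ∀ k h → (∀ x → 0# ≤ h x) → 0# ≤ sumGk′ k h
  sumGk′-nonneg k = iterated-preserves k _ (0# ≤_) (λ _ → sumG-nonneg)

  sumGk′-zero : ∀ k h → (∀ x → h x ≡ 0#) → sumGk′ k h ≡ 0#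
  sumGk′-zero k = iterated-preserves k _ (_≡ 0#) (λ _ _ → sumG-zero)

  sumGk′-*ˡ : ∀ k c h → sumGk′ k (λ x → c * h x) ≡ c * sumGk′ k h
  sumGk′-*ˡ k c = iterated-homo k _ (c *_) (λ _ → sumG-cong) (λ _ → sumG-*ˡ c)

  sumG-comm-sumGk′ : ∀ k (h : 𝔾 → (Fin k → 𝔾) → R) →
                     sumG G F (λ g → sumGk′ k (h g)) ≡ sumGk′ k (λ x → sumG G F (λ g → h g x))
  sumG-comm-sumGk′ k h = sym
    (iterated-comm k _ (sumG G F) (λ _ → sumG-cong) sumG-cong (λ _ → sumG-comm) (λ x g → h g x))

  sumGk′-comm : ∀ k m (h : (Fin k → 𝔾) → (Fin m → 𝔾) → R) →
                sumGk′ k (λ x → sumGk′ m (h x)) ≡ sumGk′ m (λ y → sumGk′ k (λ x → h x y))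
  sumGk′-comm k m =
    iterated-comm k _ (sumGk′ m) (λ _ → sumG-cong) (sumGk′-cong m) (λ _ → sumG-comm-sumGk′ m)

  sumGk′-prodFin : ∀ k g → sumGk′ k (λ x → prodFin G F k (λ a → g (x a))) ≡ sumG G F g ^ k
  sumGk′-prodFin zero    g = refl
  sumGk′-prodFin (suc k) g = begin
    sumG G F (λ y → sumGk′ k (λ x → g y * prodFin G F k (λ a → g (x a))))
      ≡⟨ sumG-cong (λ y → sumGk′-*ˡ k (g y) (λ x → prodFin G F k (λ a → g (x a)))) ⟩
    sumG G F (λ y → g y * sumGk′ k (λ x → prodFin G F k (λ a → g (x a))))
      ≡⟨ sumG-cong (λ y → cong (g y *_) (sumGk′-prodFin k g)) ⟩
    sumG G F (λ y → g y * sumG G F g ^ k)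
      ≡⟨ sumG-*ʳ g _ ⟩
    sumG G F g * sumG G F g ^ k ∎

  -- h need not respect pointwise equality, so it vanishes at some pointwise-zero vector
  -- rather than at λ _ → 0ᴳ.
  sumGk′≡0⇒vanishes-at-0 : ∀ k h → (∀ x → 0# ≤ h x) → sumGk′ k h ≡ 0# →
                           ∃ λ x → (∀ a → x a ≡ 0ᴳ) × h x ≡ 0#
  sumGk′≡0⇒vanishes-at-0 k =
    iterated-witness k _ (0# ≤_) (_≡ 0#) (λ _ x → x ≡ 0ᴳ) (λ _ → sumG-nonneg)
      (λ _ h 0≤h sum≡0 → 0ᴳ , refl , sumG≡0⇒h≡0 h 0≤h sum≡0 0ᴳ)

  sumTuples′-cong : ∀ r ks → Congruent (sumTuples′ r ks)
  sumTuples′-cong r ks = iterated-cong r _ (λ j → sumGk′-cong (ks j))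

  sumTuples′-nonneg : ∀ r ks h → (∀ x → 0# ≤ h x) → 0# ≤ sumTuples′ r ks h
  sumTuples′-nonneg r ks = iterated-preserves r _ (0# ≤_) (λ j → sumGk′-nonneg (ks j))

  sumTuples′-zero : ∀ r ks h → (∀ x → h x ≡ 0#) → sumTuples′ r ks h ≡ 0#
  sumTuples′-zero r ks = iterated-preserves r _ (_≡ 0#) (λ j → sumGk′-zero (ks j))

  sumGk′-comm-sumTuples′ : ∀ k r ks (h : (Fin k → 𝔾) → ((j : Fin r) → Fin (ks j) → 𝔾) → R) →
                           sumGk′ k (λ x → sumTuples′ r ks (h x)) ≡
                           sumTuples′ r ks (λ y → sumGk′ k (λ x → h x y))
  sumGk′-comm-sumTuples′ k r ks h = sym
    (iterated-comm r _ (sumGk′ k) (λ j → sumGk′-cong (ks j)) (sumGk′-cong k)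
                   (λ j → sumGk′-comm (ks j) k) (λ y x → h x y))

  sumTuples′≡0⇒vanishes-at-0 : ∀ r ks h → (∀ x → 0# ≤ h x) → sumTuples′ r ks h ≡ 0# →
                               ∃ λ x → (∀ j a → x j a ≡ 0ᴳ) × h x ≡ 0#
  sumTuples′≡0⇒vanishes-at-0 r ks =
    iterated-witness r _ (0# ≤_) (_≡ 0#) (λ _ x → ∀ a → x a ≡ 0ᴳ)
                     (λ j → sumGk′-nonneg (ks j)) (λ j → sumGk′≡0⇒vanishes-at-0 (ks j))

  prodBox′-cong : ∀ r ks → Congruent (prodBox′ r ks)
  prodBox′-cong r ks = iterated-cong r _ (λ j → prodFin-cong (ks j))

  prodBox′-const : ∀ r ks c → prodBox′ r ks (λ _ → c) ≡ c ^ prodℕ r ks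
  prodBox′-const zero    ks c = sym (*-identityʳ c)
  prodBox′-const (suc r) ks c = begin
    prodFin G F (ks zero) (λ _ → prodBox′ r (ks ∘ suc) (λ _ → c))
      ≡⟨ prodFin-cong (ks zero) (λ _ → prodBox′-const r (ks ∘ suc) c) ⟩
    prodFin G F (ks zero) (λ _ → c ^ K′)
      ≡⟨ prodFin-const (ks zero) _ ⟩
    (c ^ K′) ^ ks zero
      ≡⟨ ^-assocʳ c K′ (ks zero) ⟩
    c ^ (K′ ℕ.* ks zero)
      ≡⟨ cong (c ^_) (ℕ.*-comm K′ (ks zero)) ⟩
    c ^ (ks zero ℕ.* K′) ∎
    where
    K′ : ℕ
    K′ = prodℕ r (ks ∘ suc)

  prodFin-comm-prodBox′ : ∀ m r ks (h : Fin m → ((j : Fin r) → Fin (ks j)) → R) →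
                          prodFin G F m (λ a → prodBox′ r ks (h a)) ≡
                          prodBox′ r ks (λ ω → prodFin G F m (λ a → h a ω))
  prodFin-comm-prodBox′ m r ks h = sym
    (iterated-comm r _ (prodFin G F m) (λ j → prodFin-cong (ks j)) (prodFin-cong m)
                   (λ j → prodFin-comm (ks j) m) (λ ω a → h a ω))

  prodBox′-zero : ∀ r ks → (∀ j → Fin (ks j)) →
                  ∀ h → (∀ ω → h ω ≡ 0#) → prodBox′ r ks h ≡ 0#
  prodBox′-zero r ks ω₀ = iterated-preserves r _ (_≡ 0#)
    (λ j h h≡0 → prodFin-zero (ks j) h (ω₀ j) (h≡0 (ω₀ j)))

  sumGrp-cong : ∀ r {g g′} → (∀ i → g i ≡ g′ i) → sumGrp G F r g ≡ sumGrp G F r g′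
  sumGrp-cong zero    g≗g′ = refl
  sumGrp-cong (suc r) g≗g′ = cong₂ _⊕_ (g≗g′ zero) (sumGrp-cong r (g≗g′ ∘ suc))

  sumGrp-zero : ∀ r g → (∀ i → g i ≡ 0ᴳ) → sumGrp G F r g ≡ 0ᴳ
  sumGrp-zero zero    g g≡0 = refl
  sumGrp-zero (suc r) g g≡0 =
    trans (cong₂ _⊕_ (g≡0 zero) (sumGrp-zero r (g ∘ suc) (g≡0 ∘ suc))) (⊕-identityˡ 0ᴳ)

  Extensional : {A : Set} {B : A → Set} → (((a : A) → B a) → R) → Set
  Extensional h = ∀ x y → (∀ a → x a ≡ y a) → h x ≡ h y

  Extensional₂ : {A : Set} {B : A → Set} {C : Set} → (((a : A) → B a → C) → R) → Set
  Extensional₂ h = ∀ x y → (∀ a b → x a b ≡ y a b) → h x ≡ h y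

  sumGk≡sumGk′ : ∀ k {h h′} → (∀ x → h x ≡ h′ x) → Extensional h′ →
                 sumGk G F k h ≡ sumGk′ k h′
  sumGk≡sumGk′ zero    h≗h′ h′-ext = trans (h≗h′ _) (h′-ext _ _ (λ ()))
  sumGk≡sumGk′ (suc k) h≗h′ h′-ext = sumFin-cong size λ i → sumGk≡sumGk′ k
    (λ x → trans (h≗h′ _) (h′-ext _ _ λ { zero → refl ; (suc a) → refl }))
    (λ x y x≗y → h′-ext _ _ λ { zero → refl ; (suc a) → x≗y a })

  sumTuples≡sumTuples′ : ∀ r ks {h h′} → (∀ x → h x ≡ h′ x) → Extensional₂ h′ →
                         sumTuples G F r ks h ≡ sumTuples′ r ks h′
  sumTuples≡sumTuples′ zero    ks h≗h′ h′-ext = trans (h≗h′ _) (h′-ext _ _ (λ ()))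
  sumTuples≡sumTuples′ (suc r) ks h≗h′ h′-ext = sumGk≡sumGk′ (ks zero)
    (λ x → sumTuples≡sumTuples′ r (ks ∘ suc)
      (λ y → trans (h≗h′ _) (h′-ext _ _ λ { zero a → refl ; (suc i) a → refl }))
      (λ y y′ y≗y′ → h′-ext _ _ λ { zero a → refl ; (suc i) a → y≗y′ i a }))
    (λ x x′ x≗x′ → sumTuples′-cong r (ks ∘ suc) λ y →
      h′-ext _ _ λ { zero a → x≗x′ a ; (suc i) a → refl })

  prodBox≡prodBox′ : ∀ r ks {h h′} → (∀ ω → h ω ≡ h′ ω) → Extensional h′ →
                     prodBox G F r ks h ≡ prodBox′ r ks h′
  prodBox≡prodBox′ zero    ks h≗h′ h′-ext = trans (h≗h′ _) (h′-ext _ _ (λ ()))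
  prodBox≡prodBox′ (suc r) ks h≗h′ h′-ext = prodFin-cong (ks zero) λ a →
    prodBox≡prodBox′ r (ks ∘ suc)
    (λ ω → trans (h≗h′ _) (h′-ext _ _ λ { zero → refl ; (suc i) → refl }))
    (λ ω ω′ ω≗ω′ → h′-ext _ _ λ { zero → refl ; (suc i) → ω≗ω′ i })

  normEK≡normEK′ : ∀ r ks f → normEK G F r ks f ≡ normEK′ r ks f
  normEK≡normEK′ r ks f = sumTuples≡sumTuples′ r ks
    (λ x → prodBox≡prodBox′ r ks (λ ω → refl)
      λ ω ω′ ω≗ω′ → cong f (sumGrp-cong r (λ j → cong (x j) (ω≗ω′ j))))
    (λ x y x≗y → prodBox′-cong r ks λ ω → cong f (sumGrp-cong r (λ j → x≗y j (ω j))))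

  shiftedBox : ∀ r ks → (𝔾 → R) → ((j : Fin r) → Fin (ks j) → 𝔾) → 𝔾 → R
  shiftedBox r ks ψ y t = prodBox′ r ks (λ ω → ψ (t ⊕ sumGrp G F r (λ j → y j (ω j))))

  translatesProduct : ∀ k → (Fin k → 𝔾) → (𝔾 → R) → 𝔾 → R
  translatesProduct k x ψ t = prodFin G F k (λ a → ψ (x a ⊕ t))

  shiftedBox-at-0 : ∀ r ks ψ y → (∀ j a → y j a ≡ 0ᴳ) →
                    ∀ t → shiftedBox r ks ψ y t ≡ ψ t ^ prodℕ r ks
  shiftedBox-at-0 r ks ψ y y≡0 t = trans
    (prodBox′-cong r ks λ ω →
      cong ψ (trans (cong (t ⊕_) (sumGrp-zero r _ (λ j → y≡0 j (ω j)))) (⊕-identityʳ t)))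
    (prodBox′-const r ks (ψ t))

  translatesProduct-at-0 : ∀ k x ψ → (∀ a → x a ≡ 0ᴳ) →
                           ∀ t → translatesProduct k x ψ t ≡ ψ t ^ k
  translatesProduct-at-0 k x ψ x≡0 t = trans
    (prodFin-cong k λ a → cong ψ (trans (cong (_⊕ t) (x≡0 a)) (⊕-identityˡ t)))
    (prodFin-const k (ψ t))

  normEK′-suc-sum-of-powers : ∀ r ks ψ → normEK′ (suc r) ks ψ ≡
    sumTuples′ r (ks ∘ suc) (λ y → sumG G F (shiftedBox r (ks ∘ suc) ψ y) ^ ks zero)
  normEK′-suc-sum-of-powers r ks ψ = trans
    (sumGk′-comm-sumTuples′ (ks zero) r (ks ∘ suc)
      (λ x y → prodFin G F (ks zero) (λ a → shiftedBox r (ks ∘ suc) ψ y (x a))))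
    (sumTuples′-cong r (ks ∘ suc) λ y → sumGk′-prodFin (ks zero) (shiftedBox r (ks ∘ suc) ψ y))

  normEK′-suc-sum-of-norms : ∀ r ks ψ → normEK′ (suc r) ks ψ ≡
    sumGk′ (ks zero) (λ x → normEK′ r (ks ∘ suc) (translatesProduct (ks zero) x ψ))
  normEK′-suc-sum-of-norms r ks ψ = sumGk′-cong (ks zero) λ x →
    sumTuples′-cong r (ks ∘ suc) λ y → prodFin-comm-prodBox′ (ks zero) r (ks ∘ suc) _

  normEK′-nonneg : ∀ r ks (j : Fin r) → 2 ∣ ks j → ∀ ψ → 0# ≤ normEK′ r ks ψ
  normEK′-nonneg (suc r) ks zero 2∣k₀ ψ =
    subst (0# ≤_) (sym (normEK′-suc-sum-of-powers r ks ψ))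
      (sumTuples′-nonneg r (ks ∘ suc) _ (λ y → 0≤x^even 2∣k₀ _))
  normEK′-nonneg (suc r) ks (suc j) 2∣kⱼ ψ =
    subst (0# ≤_) (sym (normEK′-suc-sum-of-norms r ks ψ))
      (sumGk′-nonneg (ks zero) _ λ x →
        normEK′-nonneg r (ks ∘ suc) j 2∣kⱼ (translatesProduct (ks zero) x ψ))

  normEK′≡0⇒∑ψ^[K/kⱼ]≡0 : ∀ r ks (j : Fin r) → 2 ∣ ks j → ∀ ψ → normEK′ r ks ψ ≡ 0# →
                          sumG G F (λ t → ψ t ^ prodExcept r ks j) ≡ 0#
  normEK′≡0⇒∑ψ^[K/kⱼ]≡0 (suc r) ks zero 2∣k₀ ψ ‖ψ‖≡0
    with sumTuples′≡0⇒vanishes-at-0 r (ks ∘ suc) _ (λ y → 0≤x^even 2∣k₀ _)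
           (trans (sym (normEK′-suc-sum-of-powers r ks ψ)) ‖ψ‖≡0)
  ... | y , y≡0 , power≡0 = begin
    sumG G F (λ t → ψ t ^ prodExcept (suc r) ks zero)
      ≡⟨ sumG-cong (λ t → cong (ψ t ^_) (prodExcept-zero r ks)) ⟩
    sumG G F (λ t → ψ t ^ prodℕ r (ks ∘ suc))
      ≡⟨ sumG-cong (shiftedBox-at-0 r (ks ∘ suc) ψ y y≡0) ⟨
    sumG G F (shiftedBox r (ks ∘ suc) ψ y)
      ≡⟨ x^n≡0⇒x≡0 (ks zero) power≡0 ⟩
    0# ∎
  normEK′≡0⇒∑ψ^[K/kⱼ]≡0 (suc r) ks (suc j) 2∣kⱼ ψ ‖ψ‖≡0
    with sumGk′≡0⇒vanishes-at-0 (ks zero) _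
           (λ x → normEK′-nonneg r (ks ∘ suc) j 2∣kⱼ (translatesProduct (ks zero) x ψ))
           (trans (sym (normEK′-suc-sum-of-norms r ks ψ)) ‖ψ‖≡0)
  ... | x , x≡0 , ‖∏ψ‖≡0 = begin
    sumG G F (λ t → ψ t ^ prodExcept (suc r) ks (suc j))
      ≡⟨ sumG-cong (λ t → cong (ψ t ^_) (prodExcept-suc r ks j)) ⟩
    sumG G F (λ t → ψ t ^ (ks zero ℕ.* K′/kⱼ))
      ≡⟨ sumG-cong (λ t → ^-assocʳ (ψ t) (ks zero) K′/kⱼ) ⟨
    sumG G F (λ t → (ψ t ^ ks zero) ^ K′/kⱼ)
      ≡⟨ sumG-cong (λ t → cong (_^ K′/kⱼ) (translatesProduct-at-0 (ks zero) x ψ x≡0 t)) ⟨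
    sumG G F (λ t → translatesProduct (ks zero) x ψ t ^ K′/kⱼ)
      ≡⟨ normEK′≡0⇒∑ψ^[K/kⱼ]≡0 r (ks ∘ suc) j 2∣kⱼ (translatesProduct (ks zero) x ψ) ‖∏ψ‖≡0 ⟩
    0# ∎
    where
    K′/kⱼ : ℕ
    K′/kⱼ = prodExcept r (ks ∘ suc) j

  normEK′≡0⇒f≡0 : ∀ r ks (j : Fin r) → 2 ∣ ks j → 2 ∣ prodExcept r ks j →
                  ∀ f → normEK′ r ks f ≡ 0# → ∀ x → f x ≡ 0#
  normEK′≡0⇒f≡0 r ks j 2∣kⱼ 2∣K/kⱼ f ‖f‖≡0 x = x^n≡0⇒x≡0 (prodExcept r ks j)
    (sumG≡0⇒h≡0 _ (λ y → 0≤x^even 2∣K/kⱼ (f y)) (normEK′≡0⇒∑ψ^[K/kⱼ]≡0 r ks j 2∣kⱼ f ‖f‖≡0) x)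

  f≡0⇒normEK′≡0 : ∀ r ks → (∀ j → Fin (ks j)) → ∀ f → (∀ x → f x ≡ 0#) → normEK′ r ks f ≡ 0#
  f≡0⇒normEK′≡0 r ks ω₀ f f≡0 =
    sumTuples′-zero r ks _ λ x → prodBox′-zero r ks ω₀ _ (λ ω → f≡0 _)

open import Data.Nat using (_≤_)

lemma22 : (G : FiniteAbelianGroup) (F : OrderedField) (r : ℕ) (ks : Fin r → ℕ)
    → 2 ≤ r → (∀ j → 2 ≤ ks j)
    → (f : FiniteAbelianGroup.Carrier G → OrderedField.Carrier F)
    → (∃ λ j → (2 ∣ ks j) × (2 ∣ prodExcept r ks j))
    → (normEK G F r ks f ≡ OrderedField.0# F) ⇔ (∀ x → f x ≡ OrderedField.0# F)
lemma22 G F r ks _ 2≤k f (j , 2∣kⱼ , 2∣K/kⱼ) = mk⇔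
  (λ ‖f‖≡0 → normEK′≡0⇒f≡0 r ks j 2∣kⱼ 2∣K/kⱼ f (trans (sym (normEK≡normEK′ r ks f)) ‖f‖≡0))
  (λ f≡0 → trans (normEK≡normEK′ r ks f) (f≡0⇒normEK′≡0 r ks (λ j → fromℕ< (2≤k j)) f f≡0))
  where open Norm G F
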